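{- Let $f:\mathbb{B}^n\to\mathbb{B}^n$ be a Boolean network in which component $n$ is not autoregulated, with reduction $\tilde f$ by elimination of $n$. If $S\in\{0,1,\star\}^n$ is a trap space of $f$, $P\in\{0,1,\star\}^n$ is a subspace, and $\Phi_f^k(S)\subseteq P$ for some $k\geq 1$, then $\Phi_{\tilde f}^k(S_{[n-1]})\subseteq P_{[n-1]}$.
   Context: $\mathbb{B}=\{0,1\}$, $[n]=\{1,\dots,n\}$. For $x\in\mathbb{B}^n$, $\bar x^i$ is $x$ with coordinate $i$ flipped. Component $i$ regulates $j$ if $f_j(x)\neq f_j(\bar x^i)$ for some $x$; $n$ is autoregulated if it regulates itself. A subspace is a set $\{x: x_i=c(i)\ \forall i\in I\}$, written as $S\in\{0,1,\star\}^m$ with $S_i=c(i)$ on $I$ (fixed) and $\star$ elsewhere (free); $A_J$ is projection onto coordinates $J$. A trap space of $f$ is a subspace $T$ with $f(T)\subseteq T$. Reduction: $\sigma(x)=(x,f_n(x,0))$ and $\tilde f_i(x)=f_i(\sigma(x))$ for $x\in\mathbb{B}^{n-1}$, $i\in[n-1]$. For a network $g$ on $\mathbb{B}^m$, the propagation map $\Phi_g$ sends a subspace $S$ to the smallest subspace (under inclusion) containing $g(S)=\{g(x):x\in S\}$; $\Phi_g^k$ is its $k$-fold iterate. -}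

module Defs where

open import Data.Bool using (Bool; true; false; not; _∧_; if_then_else_)
open import Data.Maybe using (Maybe; just; nothing)
open import Data.Nat using (ℕ; zero; suc)
open import Data.Fin using (Fin; fromℕ; inject₁)
open import Data.Vec using (Vec; []; _∷_; lookup; _[_]≔_; _∷ʳ_; init; map)
open import Data.List using (List; []; _∷_; _++_; filter)
import Data.List as L
open import Data.Product using (Σ; _×_; _,_)
open import Data.Empty using (⊥)
open import Relation.Binary.PropositionalEquality using (_≡_; _≢_)
open import Relation.Nullary using (Dec; yes; no)
open import Data.Bool.Properties using () renaming (_≟_ to _≟B_)

State : ℕ → Set
State n = Vec Bool n

Network : ℕ → Set
Network n = State n → State n

flipAt : ∀ {n} → State n → Fin n → State n
flipAt x i = x [ i ]≔ not (lookup x i)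

Regulates : ∀ {n} → Network n → Fin n → Fin n → Set
Regulates f i j = Σ (State _) λ x → lookup (f x) j ≢ lookup (f (flipAt x i)) j

-- the last component (component n of B^n, n = suc m)
last : ∀ m → Fin (suc m)
last m = fromℕ m

Autoregulated : ∀ {m} → Network (suc m) → Set
Autoregulated {m} f = Regulates f (last m) (last m)

σ : ∀ {m} → Network (suc m) → State m → State (suc m)
σ f x = x ∷ʳ lookup (f (x ∷ʳ false)) (fromℕ _)

reduce : ∀ {m} → Network (suc m) → Network m
reduce f x = init (f (σ f x))

-- Subspaces {0,1,⋆}^n : nothing = ⋆ (free), just b = fixed to b
Subspace : ℕ → Set
Subspace n = Vec (Maybe Bool) n

_∈S_ : ∀ {n} → State n → Subspace n → Set
_∈S_ {n} x S = ∀ (i : Fin n) (b : Bool) → lookup S i ≡ just b → lookup x i ≡ b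

_⊆S_ : ∀ {n} → Subspace n → Subspace n → Set
_⊆S_ {n} S P = ∀ (x : State n) → x ∈S S → x ∈S P

IsTrapSpace : ∀ {n} → Network n → Subspace n → Set
IsTrapSpace f T = ∀ x → x ∈S T → f x ∈S T

proj : ∀ {m} → Subspace (suc m) → Subspace m
proj = init

allStates : ∀ n → List (State n)
allStates zero = [] ∷ []
allStates (suc n) = L.map (true ∷_) (allStates n) ++ L.map (false ∷_) (allStates n)

matches : Maybe Bool → Bool → Bool
matches nothing _ = true
matches (just true) b = b
matches (just false) b = not b

memb : ∀ {n} → Subspace n → State n → Bool
memb [] [] = true
memb (c ∷ S) (b ∷ x) = matches c b ∧ memb S x

elems : ∀ {n} → Subspace n → List (State n)
elems {n} S = filter (λ x → memb S x ≟B true) (allStates n)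

allB : {A : Set} → (A → Bool) → List A → Bool
allB p [] = true
allB p (a ∷ as) = p a ∧ allB p as

-- smallest subspace containing the (finite, nonempty) set of states xs
-- (every subspace is nonempty, so g(S) is nonempty): coordinate i is fixed
-- to b iff all states of xs have value b there, otherwise free
hull : ∀ {n} → List (State n) → Subspace n
hull {zero} xs = []
hull {suc n} xs =
  coord ∷ hull (L.map Data.Vec.tail xs)
  where
  heads = L.map Data.Vec.head xs
  coord : Maybe Bool
  coord = if allB (λ b → b) heads then just true
          else (if allB not heads then just false else nothing)

Φ : ∀ {n} → Network n → Subspace n → Subspace n
Φ g S = hull (L.map g (elems S))

Φ^ : ∀ {n} → ℕ → Network n → Subspace n → Subspace n
Φ^ zero g S = S
Φ^ (suc k) g S = Φ g (Φ^ k g S)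

{-# OPTIONS --safe #-}
-- Write T j = Φ_f^j(S). Because S is a trap space the T j decrease. Because n
-- does not regulate itself, f_n(x, c) = f_n(x, 0) for both values of c, so for x
-- in A_[n-1](T (j+1)) the lift σ(x) has the same last coordinate as f(x, c) for
-- any lift (x, c) ∈ T j; hence σ(x) ∈ T (j+1) (and likewise σ(x) ∈ S for
-- x ∈ A_[n-1](S)). Then f̃(x) = A_[n-1](f(σ x)) gives
-- Φ_f̃(A_[n-1](T j)) ⊆ A_[n-1](T (j+1)), and induction on j concludes.
module Submission where

open import Defs
open import Data.Nat using (ℕ; zero; suc; _≥_)
open import Data.Bool using (Bool; true; false; not; _∧_; if_then_else_)
open import Data.Bool.Properties using (not-injective) renaming (_≟_ to _≟B_)
open import Data.Maybe using (Maybe; just; nothing; fromMaybe)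
open import Data.Fin using (Fin; fromℕ) renaming (zero to fzero; suc to fsuc)
open import Data.Vec using ([]; _∷_; lookup; _∷ʳ_; init; tail)
import Data.Vec as V
open import Data.Vec.Properties using (lookup-map; init-∷ʳ)
import Data.List as L
open import Data.List using (List; []; _∷_)
open import Data.List.Properties using (map-cong; map-∘)
open import Data.List.Relation.Unary.All using (All; []; _∷_)
import Data.List.Relation.Unary.All as All
import Data.List.Relation.Unary.All.Properties as AllP
open import Data.List.Relation.Unary.Any using (here)
open import Data.List.Membership.Propositional using (_∈_)
open import Data.List.Membership.Propositional.Properties
  using (∈-filter⁺; ∈-filter⁻; ∈-++⁺ˡ; ∈-++⁺ʳ; ∈-map⁺)
open import Data.Product using (Σ; _×_; _,_; proj₂)
open import Data.Empty using (⊥-elim)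
open import Relation.Binary.PropositionalEquality
open import Relation.Nullary using (¬_; yes; no)

∧-true⁻ : ∀ {a b} → a ∧ b ≡ true → a ≡ true × b ≡ true
∧-true⁻ {true} {true} _ = refl , refl

allB-true⁻ : {A : Set} (p : A → Bool) (xs : List A) →
             allB p xs ≡ true → All (λ a → p a ≡ true) xs
allB-true⁻ p [] _ = []
allB-true⁻ p (a ∷ as) e with ∧-true⁻ {p a} e
... | pa , pas = pa ∷ allB-true⁻ p as pas

allB-true⁺ : {A : Set} (p : A → Bool) (xs : List A) →
             All (λ a → p a ≡ true) xs → allB p xs ≡ true
allB-true⁺ p [] [] = refl
allB-true⁺ p (a ∷ as) (pa ∷ pas) rewrite pa = allB-true⁺ p as pas

-- Coordinatewise membership: x ∈S S unfolds to ∀ i → lookup x i ∈⋆ lookup S i.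
_∈⋆_ : Bool → Maybe Bool → Set
c ∈⋆ a = ∀ b → a ≡ just b → c ≡ b

point : ∀ {n} → Subspace n → State n
point = V.map (fromMaybe false)

point-∈S : ∀ {n} (S : Subspace n) → point S ∈S S
point-∈S S i b e = trans (lookup-map i (fromMaybe false) S) (cong (fromMaybe false) e)

matches-sound : ∀ c b → matches c b ≡ true → b ∈⋆ c
matches-sound (just true) b e .true refl = e
matches-sound (just false) b e .false refl = not-injective e

matches-complete : ∀ c b → b ∈⋆ c → matches c b ≡ true
matches-complete nothing b _ = refl
matches-complete (just true) b b∈c = b∈c true refl
matches-complete (just false) b b∈c = cong not (b∈c false refl)

memb-sound : ∀ {n} (S : Subspace n) (x : State n) → memb S x ≡ true → x ∈S S
memb-sound (c ∷ S) (b ∷ x) e i with ∧-true⁻ {matches c b} e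
memb-sound (c ∷ S) (b ∷ x) e fzero | hd , _ = matches-sound c b hd
memb-sound (c ∷ S) (b ∷ x) e (fsuc i) | _ , tl = memb-sound S x tl i

memb-complete : ∀ {n} (S : Subspace n) (x : State n) → x ∈S S → memb S x ≡ true
memb-complete [] [] _ = refl
memb-complete (c ∷ S) (b ∷ x) x∈S
  rewrite matches-complete c b (x∈S fzero) = memb-complete S x (λ i → x∈S (fsuc i))

∈-allStates : ∀ n (x : State n) → x ∈ allStates n
∈-allStates zero [] = here refl
∈-allStates (suc n) (true ∷ x) = ∈-++⁺ˡ (∈-map⁺ (true ∷_) (∈-allStates n x))
∈-allStates (suc n) (false ∷ x) =
  ∈-++⁺ʳ (L.map (true ∷_) (allStates n)) (∈-map⁺ (false ∷_) (∈-allStates n x))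

∈-elems⁺ : ∀ {n} (S : Subspace n) (x : State n) → x ∈S S → x ∈ elems S
∈-elems⁺ {n} S x x∈S =
  ∈-filter⁺ (λ y → memb S y ≟B true) (∈-allStates n x) (memb-complete S x x∈S)

∈-elems⁻ : ∀ {n} (S : Subspace n) {x : State n} → x ∈ elems S → x ∈S S
∈-elems⁻ {n} S {x} x∈ =
  memb-sound S x (proj₂ (∈-filter⁻ (λ y → memb S y ≟B true) {xs = allStates n} x∈))

agree : List Bool → Maybe Bool
agree bs = if allB (λ b → b) bs then just true
           else (if allB not bs then just false else nothing)

agree-sound : ∀ bs {b} → agree bs ≡ just b → All (_≡ b) bs
agree-sound bs e with allB (λ b → b) bs in all-true
agree-sound bs refl | true = allB-true⁻ (λ b → b) bs all-true
... | false with allB not bs in all-false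
agree-sound bs refl | false | true = All.map not-injective (allB-true⁻ not bs all-false)
agree-sound bs () | false | false

agree-complete : ∀ c cs {b} → All (_≡ b) (c ∷ cs) → agree (c ∷ cs) ≡ just b
agree-complete c cs {true} all-b rewrite allB-true⁺ (λ b → b) (c ∷ cs) all-b = refl
agree-complete .false cs {false} (refl ∷ all-b)
  rewrite allB-true⁺ not cs (All.map (cong not) all-b) = refl

lookup-hull : ∀ {n} (xs : List (State n)) (i : Fin n) →
              lookup (hull xs) i ≡ agree (L.map (λ x → lookup x i) xs)
lookup-hull xs fzero = cong agree (map-cong (λ { (_ ∷ _) → refl }) xs)
lookup-hull xs (fsuc i) = begin
  lookup (hull (L.map tail xs)) i                  ≡⟨ lookup-hull (L.map tail xs) i ⟩
  agree (L.map (λ x → lookup x i) (L.map tail xs)) ≡⟨ cong agree (map-∘ xs) ⟨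
  agree (L.map (λ x → lookup (tail x) i) xs)       ≡⟨ cong agree (map-cong tail-lookup xs) ⟩
  agree (L.map (λ x → lookup x (fsuc i)) xs)       ∎
  where
    open ≡-Reasoning
    tail-lookup : ∀ (x : State (suc _)) → lookup (tail x) i ≡ lookup x (fsuc i)
    tail-lookup (_ ∷ _) = refl

∈S-hull : ∀ {n} {xs : List (State n)} {x : State n} → x ∈ xs → x ∈S hull xs
∈S-hull {xs = xs} {x} x∈xs i b e =
  All.lookup (AllP.map⁻ (agree-sound _ (trans (sym (lookup-hull xs i)) e))) x∈xs

hull-least : ∀ {n} {xs : List (State n)} {B : Subspace n} {x : State n} →
             x ∈ xs → All (_∈S B) xs → hull xs ⊆S B
hull-least {xs = z ∷ zs} _ all-B y y∈hull i b e =
  y∈hull i b (trans (lookup-hull (z ∷ zs) i)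
                    (agree-complete _ _ (AllP.map⁺ (All.map (λ x∈B → x∈B i b e) all-B))))

Φ-image : ∀ {n} (g : Network n) (A : Subspace n) x → x ∈S A → g x ∈S Φ g A
Φ-image g A x x∈A = ∈S-hull (∈-map⁺ g (∈-elems⁺ A x x∈A))

Φ-least : ∀ {n} (g : Network n) (A B : Subspace n) →
          (∀ x → x ∈S A → g x ∈S B) → Φ g A ⊆S B
Φ-least g A B g[A]⊆B =
  hull-least {B = B} (∈-map⁺ g (∈-elems⁺ A (point A) (point-∈S A)))
             (AllP.map⁺ (All.tabulate λ x∈ → g[A]⊆B _ (∈-elems⁻ A x∈)))

Φ-mono : ∀ {n} (g : Network n) (A B : Subspace n) → A ⊆S B → Φ g A ⊆S Φ g B
Φ-mono g A B A⊆B = Φ-least g A (Φ g B) λ x x∈A → Φ-image g B x (A⊆B x x∈A)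

Φ^-decreasing : ∀ {n} (g : Network n) (S : Subspace n) → IsTrapSpace g S →
                ∀ j → Φ^ (suc j) g S ⊆S Φ^ j g S
Φ^-decreasing g S trap zero = Φ-least g S S trap
Φ^-decreasing g S trap (suc j) =
  Φ-mono g (Φ^ (suc j) g S) (Φ^ j g S) (Φ^-decreasing g S trap j)

∈S-∷ʳ : ∀ {m} (A : Subspace (suc m)) (x : State m) (c : Bool) →
        x ∈S init A → c ∈⋆ lookup A (fromℕ m) → (x ∷ʳ c) ∈S A
∈S-∷ʳ (_ ∷ []) [] c _ c∈ fzero = c∈
∈S-∷ʳ (_ ∷ _ ∷ _) (_ ∷ _) c x∈ c∈ fzero = x∈ fzero
∈S-∷ʳ (_ ∷ A) (_ ∷ x) c x∈ c∈ (fsuc i) = ∈S-∷ʳ A x c (λ i → x∈ (fsuc i)) c∈ i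

∈S-init : ∀ {m} (A : Subspace (suc m)) (z : State (suc m)) → z ∈S A → init z ∈S init A
∈S-init (_ ∷ _ ∷ _) (_ ∷ _ ∷ _) z∈ fzero = z∈ fzero
∈S-init (_ ∷ A) (_ ∷ z) z∈ (fsuc i) = ∈S-init A z (λ i → z∈ (fsuc i)) i

proj-lift : ∀ {m} (A : Subspace (suc m)) (x : State m) →
            x ∈S proj A → Σ Bool λ c → (x ∷ʳ c) ∈S A
proj-lift {m} A x x∈ = c , ∈S-∷ʳ A x c x∈ (λ b e → cong (fromMaybe false) e)
  where c = fromMaybe false (lookup A (fromℕ m))

proj-mono : ∀ {m} (A B : Subspace (suc m)) → A ⊆S B → proj A ⊆S proj B
proj-mono A B A⊆B x x∈ with proj-lift A x x∈
... | c , xc∈A =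
  subst (_∈S proj B) (init-∷ʳ c x) (∈S-init B (x ∷ʳ c) (A⊆B (x ∷ʳ c) xc∈A))

flipAt-last : ∀ {m} (x : State m) → flipAt (x ∷ʳ false) (fromℕ m) ≡ x ∷ʳ true
flipAt-last [] = refl
flipAt-last (a ∷ x) = cong (a ∷_) (flipAt-last x)

¬regulates⇒flip-invariant : ∀ {n} (f : Network n) {i j : Fin n} → ¬ Regulates f i j →
                            ∀ x → lookup (f x) j ≡ lookup (f (flipAt x i)) j
¬regulates⇒flip-invariant f {i} {j} ¬reg x
  with lookup (f x) j ≟B lookup (f (flipAt x i)) j
... | yes same = same
... | no differ = ⊥-elim (¬reg (x , differ))

¬autoregulated⇒last-independent :
  ∀ {m} (f : Network (suc m)) → ¬ Autoregulated f → (x : State m) (c : Bool) →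
  lookup (f (x ∷ʳ c)) (fromℕ m) ≡ lookup (f (x ∷ʳ false)) (fromℕ m)
¬autoregulated⇒last-independent f _ x false = refl
¬autoregulated⇒last-independent {m} f ¬auto x true = begin
  lookup (f (x ∷ʳ true)) (fromℕ m)
    ≡⟨ cong (λ z → lookup (f z) (fromℕ m)) (flipAt-last x) ⟨
  lookup (f (flipAt (x ∷ʳ false) (fromℕ m))) (fromℕ m)
    ≡⟨ ¬regulates⇒flip-invariant f ¬auto (x ∷ʳ false) ⟨
  lookup (f (x ∷ʳ false)) (fromℕ m)
    ∎
  where open ≡-Reasoning

σ-∈S : ∀ {m} (f : Network (suc m)) → ¬ Autoregulated f → (A U : Subspace (suc m)) →
       (∀ z → z ∈S A → f z ∈S U) → U ⊆S A →
       ∀ x → x ∈S proj U → σ f x ∈S U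
σ-∈S {m} f ¬auto A U f[A]⊆U U⊆A x x∈ with proj-lift U x x∈
... | c , xc∈U = ∈S-∷ʳ U x _ x∈ λ b e →
  trans (sym (¬autoregulated⇒last-independent f ¬auto x c))
        (f[A]⊆U (x ∷ʳ c) (U⊆A (x ∷ʳ c) xc∈U) (fromℕ m) b e)

Φ-reduce-proj : ∀ {m} (f : Network (suc m)) (A : Subspace (suc m)) →
                (∀ x → x ∈S proj A → σ f x ∈S A) →
                Φ (reduce f) (proj A) ⊆S proj (Φ f A)
Φ-reduce-proj f A σ[A]⊆A =
  Φ-least (reduce f) (proj A) (proj (Φ f A)) λ x x∈ →
    ∈S-init (Φ f A) (f (σ f x)) (Φ-image f A (σ f x) (σ[A]⊆A x x∈))

module _ {m} {f : Network (suc m)} (¬auto : ¬ Autoregulated f)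
         {S : Subspace (suc m)} (trap : IsTrapSpace f S) where

  σ-∈S-Φ^ : ∀ j x → x ∈S proj (Φ^ j f S) → σ f x ∈S Φ^ j f S
  σ-∈S-Φ^ zero = σ-∈S f ¬auto S S trap (λ _ z∈ → z∈)
  σ-∈S-Φ^ (suc j) =
    σ-∈S f ¬auto (Φ^ j f S) (Φ^ (suc j) f S)
         (Φ-image f (Φ^ j f S)) (Φ^-decreasing f S trap j)

  Φ^-reduce-proj : ∀ j → Φ^ j (reduce f) (proj S) ⊆S proj (Φ^ j f S)
  Φ^-reduce-proj zero _ x∈ = x∈
  Φ^-reduce-proj (suc j) x x∈ =
    Φ-reduce-proj f (Φ^ j f S) (σ-∈S-Φ^ j) x
      (Φ-mono (reduce f) (Φ^ j (reduce f) (proj S)) (proj (Φ^ j f S))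
              (Φ^-reduce-proj j) x x∈)

lemma4 : ∀ (m : ℕ) (f : Network (suc m)) → ¬ Autoregulated f →
         (S P : Subspace (suc m)) → IsTrapSpace f S →
         (k : ℕ) → k ≥ 1 → Φ^ k f S ⊆S P →
         Φ^ k (reduce f) (proj S) ⊆S proj P
lemma4 m f ¬auto S P trap k _ Φ^k⊆P x x∈ =
  proj-mono (Φ^ k f S) P Φ^k⊆P x (Φ^-reduce-proj ¬auto trap k x x∈)
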